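{- A set of propositions $\operatorname{d}:\mathcal U\to\mathcal U$ is a dominance if and only if $\mathcal L_{\operatorname{d}}$ is a submonad of $\mathcal L$.
   Context: Type theory: Martin-Löf type theory with universe $\mathcal U$, function extensionality, proposition extensionality and propositional truncations. A set of propositions is $\operatorname{d}:\mathcal U\to\mathcal U$ with $\operatorname{isProp}(\operatorname{d}(X))$ and $\operatorname{d}(X)\to\operatorname{isProp}(X)$ for all $X$. It is a dominance if moreover $\operatorname{d}(1)$ and for all $P,Q:\mathcal U$, $\operatorname{d}(P)\to(P\to\operatorname{d}(Q))\to\operatorname{d}(P\times Q)$. $\mathcal L(Y):=\sum_{P:\mathcal U}\operatorname{isProp}(P)\times(P\to Y)$ is a monad (modulo raising the universe level) with unit $\eta(y)=(1,-,\lambda u.y)$ and Kleisli extension $f^\sharp(P,-,\varphi)=(\sum_{p:P}\operatorname{defined}(f(\varphi p)),-,(p,e)\mapsto\operatorname{value}(f(\varphi p))(e))$. $\mathcal L_{\operatorname{d}}(Y):=\sum_{P:\mathcal U}\operatorname{d}(P)\times(P\to Y)$, with embedding $i_Y:\mathcal L_{\operatorname{d}}(Y)\to\mathcal L(Y)$ forgetting to $(P,-,\varphi)$. $\mathcal L_{\operatorname{d}}$ is a submonad of $\mathcal L$ if each $\eta_Y$ factors through $i_Y$ and for every $f:X\to\mathcal L_{\operatorname{d}}(Y)$ there is $f':\mathcal L_{\operatorname{d}}(X)\to\mathcal L_{\operatorname{d}}(Y)$ with $i_Y\circ f'=(i_Y\circ f)^\sharp\circ i_X$. -}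

module Defs where

open import Level using (Level; _⊔_) renaming (suc to lsuc)
open import Data.Unit.Polymorphic using (⊤; tt)
open import Data.Product using (Σ; _×_; _,_; proj₁; proj₂)
open import Relation.Binary.PropositionalEquality using (_≡_; refl; subst)

private variable ℓ : Level

isProp : Set ℓ → Set ℓ
isProp X = (x y : X) → x ≡ y

FunExt : (ℓ : Level) → Set (lsuc ℓ)
FunExt ℓ = {A : Set ℓ} {B : A → Set ℓ} {f g : (a : A) → B a} →
           ((a : A) → f a ≡ g a) → f ≡ g

PropExt : (ℓ : Level) → Set (lsuc ℓ)
PropExt ℓ = {P Q : Set ℓ} → isProp P → isProp Q → (P → Q) → (Q → P) → P ≡ Q

record SetOfProps (ℓ : Level) : Set (lsuc ℓ) where
  field
    d       : Set ℓ → Set ℓ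
    d-prop  : (X : Set ℓ) → isProp (d X)
    d-isProp : (X : Set ℓ) → d X → isProp X
open SetOfProps public

isDominance : SetOfProps ℓ → Set (lsuc ℓ)
isDominance {ℓ} D =
  SetOfProps.d D ⊤ ×
  ((P Q : Set ℓ) → SetOfProps.d D P → (P → SetOfProps.d D Q) → SetOfProps.d D (P × Q))

𝓛 : Set ℓ → Set (lsuc ℓ)
𝓛 {ℓ} Y = Σ (Set ℓ) (λ P → isProp P × (P → Y))

defined : {Y : Set ℓ} → 𝓛 Y → Set ℓ
defined (P , _ , _) = P

defined-isProp : {Y : Set ℓ} → (l : 𝓛 Y) → isProp (defined l)
defined-isProp (_ , i , _) = i

value : {Y : Set ℓ} → (l : 𝓛 Y) → defined l → Y
value (_ , _ , φ) = φ

η : {Y : Set ℓ} → Y → 𝓛 Y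
η y = ⊤ , (λ _ _ → refl) , (λ _ → y)

Σ-isProp : {P : Set ℓ} {Q : P → Set ℓ} → isProp P → ((p : P) → isProp (Q p)) → isProp (Σ P Q)
Σ-isProp {Q = Q} iP iQ (p , q) (p' , q') with iP p p'
... | refl with iQ p q q'
... | refl = refl

_♯ : {X Y : Set ℓ} → (X → 𝓛 Y) → 𝓛 X → 𝓛 Y
(f ♯) (P , i , φ) =
  Σ P (λ p → defined (f (φ p))) ,
  Σ-isProp i (λ p → defined-isProp (f (φ p))) ,
  (λ { (p , e) → value (f (φ p)) e })

𝓛d : SetOfProps ℓ → Set ℓ → Set (lsuc ℓ)
𝓛d {ℓ} D Y = Σ (Set ℓ) (λ P → SetOfProps.d D P × (P → Y))

ι : (D : SetOfProps ℓ) {Y : Set ℓ} → 𝓛d D Y → 𝓛 Y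
ι D (P , δ , φ) = P , SetOfProps.d-isProp D P δ , φ

isSubmonad : SetOfProps ℓ → Set (lsuc ℓ)
isSubmonad {ℓ} D =
  ((Y : Set ℓ) → Σ (Y → 𝓛d D Y) (λ η' → (y : Y) → ι D (η' y) ≡ η y)) ×
  ((X Y : Set ℓ) (f : X → 𝓛d D Y) →
     Σ (𝓛d D X → 𝓛d D Y) (λ f' → (l : 𝓛d D X) → ι D (f' l) ≡ ((λ x → ι D (f x)) ♯) (ι D l)))

-- A dominance is exactly a set of propositions closed under dependent sums
-- Σ P Q with P and every Q p in d, plus ⊤.  The unit of 𝓛 has ⊤ as its
-- domain of definition and the Kleisli extension has such a Σ, so these two
-- closure properties are precisely what 𝓛d needs to inherit η and ♯ from 𝓛.
-- Conversely, η at ⊤ witnesses d ⊤, and extending p ↦ (Q , _ , const tt) along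
-- (P , _ , id) produces a partial element whose domain is P × Q.
module Submission where

open import Defs
open import Level using (Level)
open import Function.Bundles using (_⇔_; mk⇔)
open import Data.Unit.Polymorphic using (⊤; tt)
open import Data.Product using (Σ; _×_; _,_; proj₁; proj₂)
open import Relation.Binary.PropositionalEquality using (_≡_; refl; subst; sym; trans)
open import Axiom.UniquenessOfIdentityProofs using (UIP; module Constant⇒UIP)

private variable ℓ : Level

isProp⇒UIP : {X : Set ℓ} → isProp X → UIP X
isProp⇒UIP {X = X} i = Constant⇒UIP.≡-irrelevant canonical (λ _ _ → refl)
  where
  canonical : {x y : X} → x ≡ y → x ≡ y
  canonical {x} {y} _ = trans (sym (i x x)) (i x y)

isProp-isProp : FunExt ℓ → {X : Set ℓ} → isProp (isProp X)
isProp-isProp fe i j = fe λ x → fe λ y → isProp⇒UIP i (i x y) (j x y)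

𝓛-≡ : FunExt ℓ → {Y : Set ℓ} {P : Set ℓ} (i j : isProp P) (φ : P → Y) →
      _≡_ {A = 𝓛 Y} (P , i , φ) (P , j , φ)
𝓛-≡ fe i j φ rewrite isProp-isProp fe i j = refl

module _ {ℓ : Level} (D : SetOfProps ℓ) where

  d-resp-⇔ : PropExt ℓ → {P Q : Set ℓ} → d D P → isProp Q → (P → Q) → (Q → P) → d D Q
  d-resp-⇔ pe {P} dP iQ to from = subst (d D) (pe (d-isProp D P dP) iQ to from) dP

  defined-∈-d : {Y : Set ℓ} (l : 𝓛d D Y) {m : 𝓛 Y} → ι D l ≡ m → d D (defined m)
  defined-∈-d (_ , δ , _) refl = δ

  -- The dominance axiom only allows a Q independent of P; we apply it to
  -- Q := Σ P Q, which for each p is equivalent to Q p since P is a proposition.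
  dominance⇒d-Σ : PropExt ℓ → isDominance D → {P : Set ℓ} {Q : P → Set ℓ} →
                  d D P → ((p : P) → d D (Q p)) → d D (Σ P Q)
  dominance⇒d-Σ pe (_ , d-×) {P} {Q} dP dQ =
    d-resp-⇔ pe (d-× P (Σ P Q) dP dΣ) iΣ proj₂ (λ s → proj₁ s , s)
    where
    iP : isProp P
    iP = d-isProp D P dP

    iΣ : isProp (Σ P Q)
    iΣ = Σ-isProp iP λ p → d-isProp D (Q p) (dQ p)

    dΣ : P → d D (Σ P Q)
    dΣ p = d-resp-⇔ pe (dQ p) iΣ (p ,_) λ (p′ , q) → subst Q (iP p′ p) q

  dominance⇒submonad : FunExt ℓ → PropExt ℓ → isDominance D → isSubmonad D
  dominance⇒submonad fe pe dom@(d⊤ , _) = unit , extension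
    where
    unit : (Y : Set ℓ) → Σ (Y → 𝓛d D Y) (λ η′ → (y : Y) → ι D (η′ y) ≡ η y)
    unit Y = (λ y → ⊤ , d⊤ , λ _ → y) , λ y → 𝓛-≡ fe _ _ λ _ → y

    extension : (X Y : Set ℓ) (f : X → 𝓛d D Y) →
                Σ (𝓛d D X → 𝓛d D Y)
                  (λ f′ → (l : 𝓛d D X) → ι D (f′ l) ≡ ((λ x → ι D (f x)) ♯) (ι D l))
    extension X Y f = f′ , λ l → 𝓛-≡ fe _ _ _
      where
      f′ : 𝓛d D X → 𝓛d D Y
      f′ (P , δ , φ) =
        Σ P (λ p → proj₁ (f (φ p))) ,
        dominance⇒d-Σ pe dom δ (λ p → proj₁ (proj₂ (f (φ p)))) ,
        λ (p , e) → proj₂ (proj₂ (f (φ p))) e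

  submonad⇒dominance : isSubmonad D → isDominance D
  submonad⇒dominance (unit , extension) = d⊤ , d-×
    where
    d⊤ : d D ⊤
    d⊤ = defined-∈-d _ (proj₂ (unit ⊤) tt)

    d-× : (P Q : Set ℓ) → d D P → (P → d D Q) → d D (P × Q)
    d-× P Q dP dQ = defined-∈-d _ (proj₂ (extension P ⊤ f) (P , dP , λ p → p))
      where
      f : P → 𝓛d D ⊤
      f p = Q , dQ p , λ _ → tt

theorem5p19 : {ℓ : Level} → FunExt ℓ → PropExt ℓ → (D : SetOfProps ℓ) →
    isDominance D ⇔ isSubmonad D
theorem5p19 fe pe D = mk⇔ (dominance⇒submonad D fe pe) (submonad⇒dominance D)
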